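{- Let $k\ge 2$ and $2\le n_1\le n_2 \le \cdots \le n_k$ be integers, and let $K_{n_1,\dots,n_k}$ be the complete multipartite graph with parts of sizes $n_1,\dots,n_k$. Then: (i) If $n_1$ is even, then $\mathrm{sg_e}(K_{n_1,\dots,n_k}) = \sum_{j=2}^{k} n_j + 1$ if $n_2\in \{n_1, n_1+1\}$, and $\mathrm{sg_e}(K_{n_1,\dots,n_k}) = \sum_{j=2}^{k} n_j$ otherwise. (ii) If $n_1$ is odd, then $\mathrm{sg_e}(K_{n_1,\dots,n_k}) = \sum_{j=2}^{k} n_j + 2$ if $n_2 = n_1$, and $\mathrm{sg_e}(K_{n_1,\dots,n_k}) = \sum_{j=2}^{k} n_j$ otherwise.
   Context: All graphs are finite and simple. For a graph $G$, a set $S\subseteq V(G)$ is a strong edge geodetic set if to each (unordered) pair of vertices $u,v\in S$ one can assign one shortest $u,v$-path (or no path) such that every edge of $G$ lies on at least one of the assigned paths. The strong edge geodetic number $\mathrm{sg_e}(G)$ is the minimum cardinality of a strong edge geodetic set of $G$. -}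

module Defs where

open import Data.Nat using (ℕ; zero; suc; _≤_)
open import Data.Fin using (Fin; zero; suc; _<_)
open import Data.List using (List; length; lookup; tabulate)
open import Data.Nat.ListAction using (sum)
open import Data.List.Relation.Unary.Unique.Propositional using (Unique)
open import Data.Maybe using (Maybe; just)
open import Data.Product using (Σ; ∃; ∃-syntax; _×_; proj₁)
open import Data.Sum using (_⊎_)
open import Relation.Binary.PropositionalEquality using (_≡_; _≢_)

record Graph : Set₁ where
  field
    V : Set
    E : V → V → Set

module _ (G : Graph) where
  open Graph G

  data Walk : V → V → ℕ → Set where
    nil  : ∀ {u} → Walk u u 0
    cons : ∀ {u w v ℓ} → E u w → Walk w v ℓ → Walk u v (suc ℓ)

  data EdgeOn (x y : V) : ∀ {u v ℓ} → Walk u v ℓ → Set where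
    here  : ∀ {u w v ℓ} (e : E u w) (p : Walk w v ℓ) →
            (u ≡ x × w ≡ y) ⊎ (u ≡ y × w ≡ x) → EdgeOn x y (cons e p)
    there : ∀ {u w v ℓ} (e : E u w) {p : Walk w v ℓ} →
            EdgeOn x y p → EdgeOn x y (cons e p)

  -- A shortest u,v-path (geodesic): a walk of length ℓ such that no
  -- u,v-walk is shorter (such a walk is necessarily a path).
  record Geodesic (u v : V) : Set where
    field
      len      : ℕ
      walk     : Walk u v len
      shortest : ∀ ℓ → Walk u v ℓ → len ≤ ℓ

  -- S (a duplicate-free list of vertices) is a strong edge geodetic set:
  -- to every unordered pair {S_i, S_j} (i < j) one assigns one geodesic
  -- or nothing, so that every edge lies on at least one assigned geodesic.
  StrongEdgeGeodetic : List V → Set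
  StrongEdgeGeodetic S =
    Unique S ×
    Σ ((i j : Fin (length S)) → Maybe (Geodesic (lookup S i) (lookup S j))) λ σ →
      ∀ x y → E x y →
        ∃[ i ] ∃[ j ] (i < j × Σ (Geodesic (lookup S i) (lookup S j)) λ g →
          σ i j ≡ just g × EdgeOn x y (Geodesic.walk g))

  IsSge : ℕ → Set
  IsSge m =
    (∃[ S ] (StrongEdgeGeodetic S × length S ≡ m)) ×
    (∀ S → StrongEdgeGeodetic S → m ≤ length S)

completeMultipartite : (k : ℕ) → (Fin k → ℕ) → Graph
completeMultipartite k n = record
  { V = Σ (Fin k) (λ i → Fin (n i))
  ; E = λ x y → proj₁ x ≢ proj₁ y
  }

sumFin : (k : ℕ) → (Fin k → ℕ) → ℕ
sumFin k f = sum (tabulate f)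

-- In a complete multipartite graph every geodesic has length at most 2, and the interior
-- vertex of a geodesic of length 2 lies in another part than its two (equal-part) ends.
-- Hence for a strong edge geodetic set S the vertices outside S are pairwise non-adjacent,
-- so they lie in a single part P, and on every other part Q the map {b, c} ↦ interior vertex
-- of the geodesic assigned to {b, c} colours the edges of K_|Q| so that every vertex of Q
-- meets every vertex outside S. Such a colouring of K_q has at most δ q colours, where
-- δ q = q - 1 for q even and q - 2 for q odd: a colour met exactly once at every vertex would
-- be a perfect matching. Conversely, cyclic 1-factorisations colour every part n_j with
-- δ n_j colours, and then t ≤ min_j δ n_j vertices of the smallest part can be left outside S:
-- two vertices of a part joined by colour c < t are connected through the c-th omitted vertex.
module Submission where

open import Defs
open import Axiom.UniquenessOfIdentityProofs using (module Decidable⇒UIP)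
open import Data.Empty using (⊥)
open import Data.Fin using (Fin; zero; suc; toℕ; fromℕ<; punchIn; punchOut)
import Data.Fin as F
import Data.Fin.Properties as Finₚ
open import Data.List using (List; []; _∷_; length; lookup; concat; map; tabulate; allFin; _++_)
open import Data.List.Properties using (length-++; length-map; length-tabulate; map-tabulate; tabulate-cong)
open import Data.List.Membership.Propositional using (_∈_; _∉_)
open import Data.List.Membership.Propositional.Properties
  using (∈-lookup; ∈-tabulate⁺; ∈-allFin; ∈-map⁺; ∈-map⁻; ∈-concat⁺′; ∈-++⁺ˡ; ∈-++⁺ʳ)
open import Data.List.Membership.DecPropositional using () renaming (_∈?_ to ∈?)
import Data.List.Relation.Unary.All as All
import Data.List.Relation.Unary.All.Properties as All
open import Data.List.Relation.Unary.AllPairs using (_∷_)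
import Data.List.Relation.Unary.AllPairs.Properties as AllPairs
open import Data.List.Relation.Unary.Any using (index)
open import Data.List.Relation.Unary.Any.Properties using (lookup-index)
open import Data.List.Relation.Unary.Unique.Propositional using (Unique)
import Data.List.Relation.Unary.Unique.Propositional.Properties as Unique
open import Data.Maybe using (Maybe; just; nothing)
open import Data.Nat using (ℕ; zero; suc; _+_; _*_; _∸_; _≤_; _<_; _≟_; _<?_; z≤n; s≤s; NonZero; ≢-nonZero)
open import Data.Nat.DivMod using (_%_; %-distribˡ-+; m%n%n≡m%n; [m+n]%n≡m%n; [m+kn]%n≡m%n; m<n⇒m%n≡m; m%n<n)
open import Data.Nat.Divisibility using (_∣_; _∣?_; divides; n∣m⇒m%n≡0)
open import Data.Nat.ListAction using (sum)
open import Data.Nat.Properties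
open import Algebra.Properties.CommutativeSemigroup +-commutativeSemigroup using (x∙yz≈y∙xz)
open import Data.Product using (Σ; ∃; ∃₂; ∃-syntax; _×_; _,_; proj₁; proj₂)
open import Data.Product.Properties using (≡-dec; ,-injectiveʳ-UIP)
open import Data.Sum using (_⊎_; inj₁; inj₂)
open import Function using (_∘_)
open import Relation.Binary.Definitions using (DecidableEquality; Tri; tri<; tri≈; tri>)
open import Relation.Binary.PropositionalEquality
open import Relation.Nullary using (¬_; Dec; yes; no; ¬?)
open import Relation.Nullary.Decidable using (_⊎-dec_; _×-dec_)
open import Relation.Nullary.Negation using (contradiction)
open import Relation.Unary using (Decidable)

lookup-injective : ∀ {A : Set} {xs : List A} → Unique xs → ∀ i j → lookup xs i ≡ lookup xs j → i ≡ j
lookup-injective (_ ∷ _)                 zero    zero    _  = refl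
lookup-injective {xs = _ ∷ xs} (x∉ ∷ _) zero    (suc j) eq = contradiction eq (All.lookup x∉ (∈-lookup {xs = xs} j))
lookup-injective {xs = _ ∷ xs} (x∉ ∷ _) (suc i) zero    eq = contradiction (sym eq) (All.lookup x∉ (∈-lookup {xs = xs} i))
lookup-injective (_ ∷ u)                 (suc i) (suc j) eq = cong suc (lookup-injective u i j eq)

unique-⊆⇒length≤ : ∀ {A : Set} {xs ys : List A} → Unique xs → (∀ {x} → x ∈ xs → x ∈ ys) → length xs ≤ length ys
unique-⊆⇒length≤ {xs = xs} {ys} unique xs⊆ys = Finₚ.injective⇒≤ {f = f} f-injective
  where
  f : Fin (length xs) → Fin (length ys)
  f i = index (xs⊆ys (∈-lookup i))

  f-injective : ∀ {i j} → f i ≡ f j → i ≡ j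
  f-injective {i} {j} fi≡fj = lookup-injective unique i j
    (trans (lookup-index (xs⊆ys (∈-lookup i)))
           (trans (cong (lookup ys) fi≡fj) (sym (lookup-index (xs⊆ys (∈-lookup j))))))

length-concat : ∀ {A : Set} (xss : List (List A)) → length (concat xss) ≡ sum (map length xss)
length-concat []         = refl
length-concat (xs ∷ xss) = trans (length-++ xs) (cong (length xs +_) (length-concat xss))

AtMost : {X : Set} → ℕ → (X → Set) → Set
AtMost {X} b T = Σ (List X) λ W → length W ≤ b × (∀ {y} → T y → y ∈ W)

atMost-mono : ∀ {X : Set} {T : X → Set} {b b′} → b ≤ b′ → AtMost b T → AtMost b′ T
atMost-mono b≤b′ (W , |W|≤b , T⊆W) = W , ≤-trans |W|≤b b≤b′ , T⊆W

module _ {X : Set} (T : X → Set) where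

  Exhausts : ∀ {p} → (Fin p → X) → Set
  Exhausts r = ∀ {y} → T y → ∃ λ s → r s ≡ y

  Redundant : ∀ {p} → (Fin p → X) → Fin p → Set
  Redundant r t = ¬ T (r t) ⊎ ∃ λ s → s ≢ t × r s ≡ r t

  exhausts⇒atMost : ∀ {p} (r : Fin p → X) → Exhausts r → AtMost p T
  exhausts⇒atMost r exhausts = tabulate r , ≤-reflexive (length-tabulate r) ,
    λ Ty → subst (_∈ tabulate r) (proj₂ (exhausts Ty)) (∈-tabulate⁺ (proj₁ (exhausts Ty)))

  redundant⇒atMost : ∀ {p} (r : Fin p → X) (t : Fin p) → Exhausts r → Redundant r t → AtMost (p ∸ 1) T
  redundant⇒atMost {suc p} r t exhausts redundant = exhausts⇒atMost (r ∘ punchIn t) exhausts′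
    where
    skipping : ∀ {s y} → s ≢ t → r s ≡ y → ∃ λ s′ → r (punchIn t s′) ≡ y
    skipping s≢t rs≡y = punchOut (s≢t ∘ sym) , trans (cong r (Finₚ.punchIn-punchOut _)) rs≡y

    reroute : Redundant r t → ∀ {y} → T y → r t ≡ y → ∃ λ s′ → r (punchIn t s′) ≡ y
    reroute (inj₁ ¬Trt)              Ty rt≡y = contradiction (subst T (sym rt≡y) Ty) ¬Trt
    reroute (inj₂ (s , s≢t , rs≡rt)) _  rt≡y = skipping s≢t (trans rs≡rt rt≡y)

    exhausts′ : Exhausts (r ∘ punchIn t)
    exhausts′ Ty with s , rs≡y ← exhausts Ty with s Finₚ.≟ t
    ... | no s≢t   = skipping s≢t rs≡y
    ... | yes refl = reroute redundant Ty rs≡y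

data EvenOdd : ℕ → Set where
  even : ∀ r → EvenOdd (r + r)
  odd  : ∀ r → EvenOdd (suc (r + r))

evenOdd : ∀ q → EvenOdd q
evenOdd zero = even 0
evenOdd (suc q) with evenOdd q
... | even r = odd r
... | odd r  = subst EvenOdd (cong suc (+-suc r r)) (even (suc r))

2∣r+r : ∀ r → 2 ∣ r + r
2∣r+r r = divides r (trans (cong (r +_) (sym (+-identityʳ r))) (*-comm 2 r))

¬2∣1+r+r : ∀ r → ¬ 2 ∣ suc (r + r)
¬2∣1+r+r r 2∣1+r+r = contradiction (begin
  1                  ≡⟨ [m+kn]%n≡m%n 1 r 2 ⟨
  (1 + r * 2) % 2    ≡⟨ cong (λ x → suc x % 2) (trans (*-comm r 2) (cong (r +_) (+-identityʳ r))) ⟩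
  suc (r + r) % 2    ≡⟨ n∣m⇒m%n≡0 _ 2 2∣1+r+r ⟩
  0                  ∎) 1+n≢0
  where open ≡-Reasoning

2∣⇒¬2∣suc : ∀ {a} → 2 ∣ a → ¬ 2 ∣ suc a
2∣⇒¬2∣suc {a} 2∣a with evenOdd a
... | even r = ¬2∣1+r+r r
... | odd r  = contradiction 2∣a (¬2∣1+r+r r)

¬2∣⇒2∣suc : ∀ {a} → ¬ 2 ∣ a → 2 ∣ suc a
¬2∣⇒2∣suc {a} ¬2∣a with evenOdd a
... | even r = contradiction (2∣r+r r) ¬2∣a
... | odd r  = subst (2 ∣_) (cong suc (+-suc r r)) (2∣r+r (suc r))

-- The largest number of colours of a full colouring (below) of K_q, for q ≥ 2.
δ : ℕ → ℕ
δ q with 2 ∣? q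
... | yes _ = q ∸ 1
... | no _  = q ∸ 2

δ-even : ∀ {q} → 2 ∣ q → δ q ≡ q ∸ 1
δ-even {q} 2∣q with 2 ∣? q
... | yes _   = refl
... | no ¬2∣q = contradiction 2∣q ¬2∣q

δ-odd : ∀ {q} → ¬ 2 ∣ q → δ q ≡ q ∸ 2
δ-odd {q} ¬2∣q with 2 ∣? q
... | yes 2∣q = contradiction 2∣q ¬2∣q
... | no _    = refl

∸2≤δ : ∀ q → q ∸ 2 ≤ δ q
∸2≤δ q with 2 ∣? q
... | yes _ = ∸-monoʳ-≤ q (s≤s z≤n)
... | no _  = ≤-refl

δ≤ : ∀ q → δ q ≤ q
δ≤ q with 2 ∣? q
... | yes _ = m∸n≤m q 1
... | no _  = m∸n≤m q 2

even≤⇒∸1≤δ : ∀ {a b} → 2 ∣ a → a ≤ b → a ∸ 1 ≤ δ b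
even≤⇒∸1≤δ {a} {b} 2∣a a≤b with 2 ∣? b
... | yes _   = ∸-monoˡ-≤ 1 a≤b
... | no ¬2∣b = ∸-monoˡ-≤ 2 (≤∧≢⇒< a≤b λ { refl → ¬2∣b 2∣a })

odd<⇒≤δ : ∀ {a b} → ¬ 2 ∣ a → a < b → a ≤ δ b
odd<⇒≤δ {a} {b} ¬2∣a a<b with 2 ∣? b
... | yes _   = ∸-monoˡ-≤ 1 a<b
... | no ¬2∣b = ∸-monoˡ-≤ 2 (≤∧≢⇒< a<b λ { refl → ¬2∣b (¬2∣⇒2∣suc ¬2∣a) })

-- Colourings of complete graphs

fixedPointFree-involution⇒even : ∀ {q} (g : Fin q → Fin q) →
                                 (∀ x → g (g x) ≡ x) → (∀ x → g x ≢ x) → 2 ∣ q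
fixedPointFree-involution⇒even {zero}        g involutive fpf = divides 0 refl
fixedPointFree-involution⇒even {suc zero}    g involutive fpf with g zero in g0≡0
... | zero = contradiction g0≡0 (fpf zero)
fixedPointFree-involution⇒even {suc (suc r)} g involutive fpf with g zero in g0≡
... | zero  = contradiction g0≡ (fpf zero)
... | suc b = 2∣2+ (fixedPointFree-involution⇒even h h-involutive h-fpf)
  where
  -- h is g restricted to the complement of its 2-cycle {0, 1 + b}
  2∣2+ : 2 ∣ r → 2 ∣ suc (suc r)
  2∣2+ (divides k r≡k*2) = divides (suc k) (cong (2 +_) r≡k*2)

  e : Fin r → Fin (suc (suc r))
  e i = suc (punchIn b i)

  e-injective : ∀ {i j} → e i ≡ e j → i ≡ j
  e-injective = Finₚ.punchIn-injective b _ _ ∘ Finₚ.suc-injective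

  e-surjective : ∀ y → y ≢ zero → y ≢ suc b → Σ (Fin r) λ i → e i ≡ y
  e-surjective zero    y≢0 _     = contradiction refl y≢0
  e-surjective (suc c) _   y≢1+b = punchOut b≢c , cong suc (Finₚ.punchIn-punchOut b≢c)
    where b≢c = y≢1+b ∘ cong suc ∘ sym

  open ≡-Reasoning

  g-e≢0 : ∀ i → g (e i) ≢ zero
  g-e≢0 i g-eᵢ≡0 = Finₚ.punchInᵢ≢i b i (Finₚ.suc-injective (begin
    e i           ≡⟨ involutive (e i) ⟨
    g (g (e i))   ≡⟨ cong g g-eᵢ≡0 ⟩
    g zero        ≡⟨ g0≡ ⟩
    suc b         ∎))

  g-e≢1+b : ∀ i → g (e i) ≢ suc b
  g-e≢1+b i g-eᵢ≡1+b = Finₚ.0≢1+n (begin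
    zero          ≡⟨ involutive zero ⟨
    g (g zero)    ≡⟨ cong g (trans g0≡ (sym g-eᵢ≡1+b)) ⟩
    g (g (e i))   ≡⟨ involutive (e i) ⟩
    e i           ∎)

  h : Fin r → Fin r
  h i = proj₁ (e-surjective (g (e i)) (g-e≢0 i) (g-e≢1+b i))

  e-h : ∀ i → e (h i) ≡ g (e i)
  e-h i = proj₂ (e-surjective (g (e i)) (g-e≢0 i) (g-e≢1+b i))

  h-involutive : ∀ i → h (h i) ≡ i
  h-involutive i = e-injective (trans (e-h (h i)) (trans (cong g (e-h i)) (involutive (e i))))

  h-fpf : ∀ i → h i ≢ i
  h-fpf i hᵢ≡i = fpf (e i) (trans (sym (e-h i)) (cong e hᵢ≡i))

module ColourClasses {X : Set} (_≟ˣ_ : DecidableEquality X) {T : X → Set} (T? : Decidable T) {q : ℕ}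
  (f : Fin (suc q) → Fin (suc q) → X) (f-sym : ∀ a b → f a b ≡ f b a)
  (meets : ∀ a {y} → T y → ∃ λ b → b ≢ a × f a b ≡ y) where

  row : Fin (suc q) → Fin q → X
  row a t = f a (punchIn a t)

  row-exhausts : ∀ a → Exhausts T (row a)
  row-exhausts a Ty with b , b≢a , fab≡y ← meets a Ty =
    punchOut (b≢a ∘ sym) , trans (cong (f a) (Finₚ.punchIn-punchOut _)) fab≡y

  redundant? : Dec (∃₂ λ a t → Redundant T (row a) t)
  redundant? = Finₚ.any? λ a → Finₚ.any? λ t →
    ¬? (T? (row a t)) ⊎-dec Finₚ.any? (λ s → ¬? (s Finₚ.≟ t) ×-dec (row a s ≟ˣ row a t))

  module Irredundant (irredundant : ∀ a t → ¬ Redundant T (row a) t) where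

    f-injective : ∀ a {b c} → b ≢ a → c ≢ a → f a b ≡ f a c → b ≡ c
    f-injective a {b} {c} b≢a c≢a fab≡fac with punchOut (b≢a ∘ sym) Finₚ.≟ punchOut (c≢a ∘ sym)
    ... | yes s≡t = trans (sym (Finₚ.punchIn-punchOut _)) (trans (cong (punchIn a) s≡t) (Finₚ.punchIn-punchOut _))
    ... | no s≢t  = contradiction
      (inj₂ (_ , s≢t , trans (cong (f a) (Finₚ.punchIn-punchOut _))
                             (trans fab≡fac (sym (cong (f a) (Finₚ.punchIn-punchOut _))))))
      (irredundant a _)

    -- each vertex meets y₀ exactly once, so the y₀-partner map is a fixed-point-free involution
    colour⇒even : ∀ {y₀} → T y₀ → 2 ∣ suc q
    colour⇒even {y₀} Ty₀ = fixedPointFree-involution⇒even g g-involutive g-fpf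
      where
      g : Fin (suc q) → Fin (suc q)
      g a = proj₁ (meets a Ty₀)

      g-fpf : ∀ a → g a ≢ a
      g-fpf a = proj₁ (proj₂ (meets a Ty₀))

      f-g : ∀ a → f a (g a) ≡ y₀
      f-g a = proj₂ (proj₂ (meets a Ty₀))

      g-involutive : ∀ a → g (g a) ≡ a
      g-involutive a = f-injective (g a) (g-fpf (g a)) (g-fpf a ∘ sym)
                         (trans (f-g (g a)) (trans (sym (f-g a)) (f-sym a (g a))))

  odd⇒atMost : ¬ 2 ∣ suc q → AtMost (q ∸ 1) T
  odd⇒atMost ¬2∣ with Finₚ.any? (λ t → T? (row zero t)) | redundant?
  ... | no noColour    | _                 =
    [] , z≤n , λ Ty → contradiction (_ , subst T (sym (proj₂ (row-exhausts zero Ty))) Ty) noColour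
  ... | yes _          | yes (a , t , red) = redundant⇒atMost T (row a) t (row-exhausts a) red
  ... | yes (_ , Ty₀)  | no none           =
    contradiction (Irredundant.colour⇒even (λ a t red → none (a , t , red)) Ty₀) ¬2∣

  atMost-δ : AtMost (δ (suc q)) T
  atMost-δ with 2 ∣? suc q
  ... | yes _   = exhausts⇒atMost T (row zero) (row-exhausts zero)
  ... | no ¬2∣ = odd⇒atMost ¬2∣

colourClasses-atMost : ∀ {X : Set} → DecidableEquality X → {T : X → Set} → Decidable T → ∀ {p} → Fin p →
  (f : Fin p → Fin p → X) → (∀ a b → f a b ≡ f b a) → (∀ a {y} → T y → ∃ λ b → b ≢ a × f a b ≡ y) →
  AtMost (δ p) T
colourClasses-atMost _≟ˣ_ T? {suc q} _ f f-sym meets = ColourClasses.atMost-δ _≟ˣ_ T? f f-sym meets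

-- A (not necessarily proper) colouring of the edges of K_q on the vertices a < q in which every
-- vertex a meets every colour c < D, namely at the vertex partner a c.
record FullColouring (q D : ℕ) : Set where
  field
    colour         : ℕ → ℕ → ℕ
    colour-sym     : ∀ a b → colour a b ≡ colour b a
    partner        : ℕ → ℕ → ℕ
    partner<       : ∀ {a c} → a < q → c < D → partner a c < q
    partner≢       : ∀ {a c} → a < q → c < D → partner a c ≢ a
    colour-partner : ∀ {a c} → a < q → c < D → colour a (partner a c) ≡ c

-- The 1-factorisation of K_(m+1), m odd: the vertices a < m form ℤ_m with colour a + b, and the
-- vertex m is joined to a by colour 2a; h is the inverse of 2 modulo m.
module CyclicColouring (m h : ℕ) .{{_ : NonZero m}} (half : h + h ≡ suc m) where

  colour : ℕ → ℕ → ℕ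
  colour a b with a ≟ m | b ≟ m
  ... | yes _ | _     = (b + b) % m
  ... | no _  | yes _ = (a + a) % m
  ... | no _  | no _  = (a + b) % m

  colour-sym : ∀ a b → colour a b ≡ colour b a
  colour-sym a b with a ≟ m | b ≟ m
  ... | yes refl | yes refl = refl
  ... | yes refl | no _     = refl
  ... | no _     | yes refl = refl
  ... | no _     | no _     = cong (_% m) (+-comm a b)

  colour-∞ˡ : ∀ b → colour m b ≡ (b + b) % m
  colour-∞ˡ b with m ≟ m
  ... | yes _  = refl
  ... | no m≢m = contradiction refl m≢m

  colour-∞ʳ : ∀ {a} → a ≢ m → colour a m ≡ (a + a) % m
  colour-∞ʳ {a} a≢m with a ≟ m | m ≟ m
  ... | yes a≡m | _      = contradiction a≡m a≢m
  ... | no _    | yes _  = refl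
  ... | no _    | no m≢m = contradiction refl m≢m

  colour-finite : ∀ {a b} → a ≢ m → b ≢ m → colour a b ≡ (a + b) % m
  colour-finite {a} {b} a≢m b≢m with a ≟ m | b ≟ m
  ... | yes a≡m | _       = contradiction a≡m a≢m
  ... | no _    | yes b≡m = contradiction b≡m b≢m
  ... | no _    | no _    = refl

  opposite : ℕ → ℕ → ℕ
  opposite a c = (c + (m ∸ a)) % m

  halve : ℕ → ℕ
  halve c = (c * h) % m

  partner : ℕ → ℕ → ℕ
  partner a c with a ≟ m
  ... | yes _ = halve c
  ... | no _ with opposite a c ≟ a
  ...   | yes _ = m
  ...   | no _  = opposite a c

  partner-∞ : ∀ c → partner m c ≡ halve c
  partner-∞ c with m ≟ m
  ... | yes _  = refl
  ... | no m≢m = contradiction refl m≢m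

  partner-self : ∀ {a c} → a ≢ m → opposite a c ≡ a → partner a c ≡ m
  partner-self {a} {c} a≢m o≡a with a ≟ m
  ... | yes a≡m = contradiction a≡m a≢m
  ... | no _ with opposite a c ≟ a
  ...   | yes _  = refl
  ...   | no o≢a = contradiction o≡a o≢a

  partner-opposite : ∀ {a c} → a ≢ m → opposite a c ≢ a → partner a c ≡ opposite a c
  partner-opposite {a} {c} a≢m o≢a with a ≟ m
  ... | yes a≡m = contradiction a≡m a≢m
  ... | no _ with opposite a c ≟ a
  ...   | yes o≡a = contradiction o≡a o≢a
  ...   | no _    = refl

  partner< : ∀ {a c} → a < suc m → c < m → partner a c < suc m
  partner< {a} {c} _ _ with a ≟ m
  ... | yes _ = m<n⇒m<1+n (m%n<n (c * h) m)
  ... | no _ with opposite a c ≟ a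
  ...   | yes _ = n<1+n m
  ...   | no _  = m<n⇒m<1+n (m%n<n (c + (m ∸ a)) m)

  partner≢ : ∀ {a c} → a < suc m → c < m → partner a c ≢ a
  partner≢ {a} {c} _ _ with a ≟ m
  ... | yes refl = <⇒≢ (m%n<n (c * h) m)
  ... | no a≢m with opposite a c ≟ a
  ...   | yes _  = a≢m ∘ sym
  ...   | no o≢a = o≢a

  open ≡-Reasoning

  [a+b%m]%m : ∀ a b → (a + b % m) % m ≡ (a + b) % m
  [a+b%m]%m a b = begin
    (a + b % m) % m           ≡⟨ %-distribˡ-+ a (b % m) m ⟩
    (a % m + b % m % m) % m   ≡⟨ cong (λ x → (a % m + x) % m) (m%n%n≡m%n b m) ⟩
    (a % m + b % m) % m       ≡⟨ %-distribˡ-+ a b m ⟨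
    (a + b) % m               ∎

  +-opposite : ∀ {a c} → a < m → c < m → (a + opposite a c) % m ≡ c
  +-opposite {a} {c} a<m c<m = begin
    (a + (c + (m ∸ a)) % m) % m ≡⟨ [a+b%m]%m a (c + (m ∸ a)) ⟩
    (a + (c + (m ∸ a))) % m     ≡⟨ cong (_% m) (x∙yz≈y∙xz a c (m ∸ a)) ⟩
    (c + (a + (m ∸ a))) % m     ≡⟨ cong (λ x → (c + x) % m) (m+[n∸m]≡n (<⇒≤ a<m)) ⟩
    (c + m) % m                 ≡⟨ [m+n]%n≡m%n c m ⟩
    c % m                       ≡⟨ m<n⇒m%n≡m c<m ⟩
    c                           ∎

  halve-+ : ∀ {c} → c < m → (halve c + halve c) % m ≡ c
  halve-+ {c} c<m = begin
    ((c * h) % m + (c * h) % m) % m ≡⟨ %-distribˡ-+ (c * h) (c * h) m ⟨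
    (c * h + c * h) % m             ≡⟨ cong (_% m) (*-distribˡ-+ c h h) ⟨
    (c * (h + h)) % m               ≡⟨ cong (λ x → (c * x) % m) half ⟩
    (c * suc m) % m                 ≡⟨ cong (_% m) (*-suc c m) ⟩
    (c + c * m) % m                 ≡⟨ [m+kn]%n≡m%n c c m ⟩
    c % m                           ≡⟨ m<n⇒m%n≡m c<m ⟩
    c                               ∎

  colour-partner-∞ : ∀ {c} → c < m → colour m (partner m c) ≡ c
  colour-partner-∞ {c} c<m = begin
    colour m (partner m c)   ≡⟨ cong (colour m) (partner-∞ c) ⟩
    colour m (halve c)       ≡⟨ colour-∞ˡ (halve c) ⟩
    (halve c + halve c) % m  ≡⟨ halve-+ c<m ⟩
    c                        ∎

  colour-partner-finite : ∀ {a c} → a < m → c < m → colour a (partner a c) ≡ c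
  colour-partner-finite {a} {c} a<m c<m = byCase (opposite a c ≟ a)
    where
    a≢m = <⇒≢ a<m
    byCase : Dec (opposite a c ≡ a) → colour a (partner a c) ≡ c
    byCase (yes o≡a) = begin
      colour a (partner a c)    ≡⟨ cong (colour a) (partner-self a≢m o≡a) ⟩
      colour a m                ≡⟨ colour-∞ʳ a≢m ⟩
      (a + a) % m               ≡⟨ cong (λ x → (a + x) % m) o≡a ⟨
      (a + opposite a c) % m    ≡⟨ +-opposite a<m c<m ⟩
      c                         ∎
    byCase (no o≢a) = begin
      colour a (partner a c)    ≡⟨ cong (colour a) (partner-opposite a≢m o≢a) ⟩
      colour a (opposite a c)   ≡⟨ colour-finite a≢m (<⇒≢ (m%n<n (c + (m ∸ a)) m)) ⟩
      (a + opposite a c) % m    ≡⟨ +-opposite a<m c<m ⟩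
      c                         ∎

  colour-partner : ∀ {a c} → a < suc m → c < m → colour a (partner a c) ≡ c
  colour-partner a≤m c<m with m≤n⇒m<n∨m≡n (≤-pred a≤m)
  ... | inj₁ a<m  = colour-partner-finite a<m c<m
  ... | inj₂ refl = colour-partner-∞ c<m

  colouring : FullColouring (suc m) m
  colouring = record
    { colour = colour ; colour-sym = colour-sym ; partner = partner
    ; partner< = partner< ; partner≢ = partner≢ ; colour-partner = colour-partner }

module Extension {q D : ℕ} (C : FullColouring q D) (D≤q : D ≤ q) where
  open FullColouring C

  colour⁺ : ℕ → ℕ → ℕ
  colour⁺ a b with a ≟ q | b ≟ q
  ... | yes _ | _     = b
  ... | no _  | yes _ = a
  ... | no _  | no _  = colour a b

  colour⁺-sym : ∀ a b → colour⁺ a b ≡ colour⁺ b a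
  colour⁺-sym a b with a ≟ q | b ≟ q
  ... | yes refl | yes refl = refl
  ... | yes refl | no _     = refl
  ... | no _     | yes refl = refl
  ... | no _     | no _     = colour-sym a b

  colour⁺-new : ∀ b → colour⁺ q b ≡ b
  colour⁺-new b with q ≟ q
  ... | yes _  = refl
  ... | no q≢q = contradiction refl q≢q

  colour⁺-old : ∀ {a b} → a ≢ q → b ≢ q → colour⁺ a b ≡ colour a b
  colour⁺-old {a} {b} a≢q b≢q with a ≟ q | b ≟ q
  ... | yes a≡q | _       = contradiction a≡q a≢q
  ... | no _    | yes b≡q = contradiction b≡q b≢q
  ... | no _    | no _    = refl

  partner⁺ : ℕ → ℕ → ℕ
  partner⁺ a c with a ≟ q
  ... | yes _ = c
  ... | no _  = partner a c

  partner⁺-new : ∀ c → partner⁺ q c ≡ c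
  partner⁺-new c with q ≟ q
  ... | yes _  = refl
  ... | no q≢q = contradiction refl q≢q

  partner⁺-old : ∀ {a} c → a ≢ q → partner⁺ a c ≡ partner a c
  partner⁺-old {a} c a≢q with a ≟ q
  ... | yes a≡q = contradiction a≡q a≢q
  ... | no _    = refl

  partner⁺< : ∀ {a c} → a < suc q → c < D → partner⁺ a c < suc q
  partner⁺< {a} {c} a≤q c<D with a ≟ q
  ... | yes _   = m<n⇒m<1+n (<-≤-trans c<D D≤q)
  ... | no a≢q = m<n⇒m<1+n (partner< (≤∧≢⇒< (≤-pred a≤q) a≢q) c<D)

  partner⁺≢ : ∀ {a c} → a < suc q → c < D → partner⁺ a c ≢ a
  partner⁺≢ {a} {c} a≤q c<D with a ≟ q
  ... | yes refl = <⇒≢ (<-≤-trans c<D D≤q)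
  ... | no a≢q  = partner≢ (≤∧≢⇒< (≤-pred a≤q) a≢q) c<D

  colour⁺-partner⁺ : ∀ {a c} → a < suc q → c < D → colour⁺ a (partner⁺ a c) ≡ c
  colour⁺-partner⁺ {a} {c} a≤q c<D with m≤n⇒m<n∨m≡n (≤-pred a≤q)
  ... | inj₂ refl = trans (cong (colour⁺ q) (partner⁺-new c)) (colour⁺-new c)
  ... | inj₁ a<q  = begin
    colour⁺ a (partner⁺ a c) ≡⟨ cong (colour⁺ a) (partner⁺-old c (<⇒≢ a<q)) ⟩
    colour⁺ a (partner a c)  ≡⟨ colour⁺-old (<⇒≢ a<q) (<⇒≢ (partner< a<q c<D)) ⟩
    colour a (partner a c)   ≡⟨ colour-partner a<q c<D ⟩
    c                        ∎
    where open ≡-Reasoning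

  colouring : FullColouring (suc q) D
  colouring = record
    { colour = colour⁺ ; colour-sym = colour⁺-sym ; partner = partner⁺
    ; partner< = partner⁺< ; partner≢ = partner⁺≢ ; colour-partner = colour⁺-partner⁺ }

evenColouring : ∀ r → FullColouring (suc r + suc r) (r + suc r)
evenColouring r = CyclicColouring.colouring (r + suc r) (suc r) {{≢-nonZero (m+1+n≢0 r)}} refl

fullColouring : ∀ q → 2 ≤ q → FullColouring q (δ q)
fullColouring q 2≤q with evenOdd q
... | even (suc r) = subst (FullColouring _) (sym (δ-even (2∣r+r (suc r)))) (evenColouring r)
... | odd (suc r)  = subst (FullColouring _) (sym (δ-odd (¬2∣1+r+r (suc r))))
                       (Extension.colouring (evenColouring r) (n≤1+n _))
... | even zero    = contradiction 2≤q λ ()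
... | odd zero     = contradiction 2≤q λ { (s≤s ()) }

-- Walks and strong edge geodetic sets

module _ {G : Graph} where
  open Graph G

  walk₀⇒≡ : ∀ {u v} → Walk G u v 0 → u ≡ v
  walk₀⇒≡ nil = refl

  second : ∀ {u v ℓ} → Walk G u v ℓ → V
  second {u} nil            = u
  second (cons {w = w} _ _) = w

  EdgeOn-sym : ∀ {x y u v ℓ} {w : Walk G u v ℓ} → EdgeOn G x y w → EdgeOn G y x w
  EdgeOn-sym (here e p (inj₁ xy)) = here e p (inj₂ xy)
  EdgeOn-sym (here e p (inj₂ yx)) = here e p (inj₁ yx)
  EdgeOn-sym (there e p)          = there e (EdgeOn-sym p)

  edgeOn-interior : ∀ {x y u v ℓ} (w : Walk G u v ℓ) → ℓ ≤ 2 → EdgeOn G x y w → y ≢ u → y ≢ v →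
                    ℓ ≡ 2 × second w ≡ y × (x ≡ u ⊎ x ≡ v)
  edgeOn-interior (cons _ nil) _ (here _ _ (inj₁ (_ , v≡y))) _   y≢v = contradiction (sym v≡y) y≢v
  edgeOn-interior (cons _ nil) _ (here _ _ (inj₂ (u≡y , _))) y≢u _   = contradiction (sym u≡y) y≢u
  edgeOn-interior (cons _ (cons _ nil)) _ (here _ _ (inj₁ (u≡x , w≡y))) _ _ = refl , w≡y , inj₁ (sym u≡x)
  edgeOn-interior (cons _ (cons _ nil)) _ (here _ _ (inj₂ (u≡y , _))) y≢u _ = contradiction (sym u≡y) y≢u
  edgeOn-interior (cons _ (cons _ nil)) _ (there _ (here _ _ (inj₁ (_ , v≡y)))) _ y≢v = contradiction (sym v≡y) y≢v
  edgeOn-interior (cons _ (cons _ nil)) _ (there _ (here _ _ (inj₂ (w≡y , v≡x)))) _ _ = refl , w≡y , inj₂ (sym v≡x)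
  edgeOn-interior (cons _ (cons _ (cons _ _))) (s≤s (s≤s ())) _ _ _

  Covers : ((u v : V) → Maybe (Geodesic G u v)) → V → V → V → V → Set
  Covers τ x y u v = Σ (Geodesic G u v) λ g → τ u v ≡ just g × EdgeOn G x y (Geodesic.walk g)

  covers-sym : ∀ {τ x y u v} → Covers τ x y u v → Covers τ y x u v
  covers-sym (g , τ≡g , on) = g , τ≡g , EdgeOn-sym on

  assignment⇒strongEdgeGeodetic :
    (S : List V) → Unique S → (τ : (u v : V) → Maybe (Geodesic G u v)) →
    (∀ x y → E x y → Σ V λ u → Σ V λ v →
       u ∈ S × v ∈ S × u ≢ v × Covers τ x y u v × Covers τ x y v u) →
    StrongEdgeGeodetic G S
  assignment⇒strongEdgeGeodetic S unique τ covered = unique , σ , cover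
    where
    σ : (i j : Fin (length S)) → Maybe (Geodesic G (lookup S i) (lookup S j))
    σ i j = τ (lookup S i) (lookup S j)

    atIndices : ∀ {x y u v} (u∈S : u ∈ S) (v∈S : v ∈ S) → Covers τ x y u v →
                Covers τ x y (lookup S (index u∈S)) (lookup S (index v∈S))
    atIndices u∈S v∈S = subst₂ (Covers τ _ _) (lookup-index u∈S) (lookup-index v∈S)

    cover : ∀ x y → E x y → ∃[ i ] ∃[ j ] (i F.< j × Covers τ x y (lookup S i) (lookup S j))
    cover x y e with u , v , u∈S , v∈S , u≢v , uv , vu ← covered x y e
                with Finₚ.<-cmp (index u∈S) (index v∈S)
    ... | tri< i<j _ _ = index u∈S , index v∈S , i<j , atIndices u∈S v∈S uv
    ... | tri≈ _ i≡j _ = contradiction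
      (trans (lookup-index u∈S) (trans (cong (lookup S) i≡j) (sym (lookup-index v∈S)))) u≢v
    ... | tri> _ _ j<i = index v∈S , index u∈S , j<i , atIndices v∈S u∈S vu

-- Complete multipartite graphs

module CompleteMultipartite {k : ℕ} (n : Fin k → ℕ) where

  G : Graph
  G = completeMultipartite k n

  V : Set
  V = Graph.V G

  part : V → Fin k
  part = proj₁

  vertex : (i : Fin k) → Fin (n i) → V
  vertex = _,_

  _≟ᵛ_ : DecidableEquality V
  _≟ᵛ_ = ≡-dec Finₚ._≟_ Finₚ._≟_

  geodesic-adjacent : ∀ {u v} → part u ≢ part v → Geodesic G u v
  geodesic-adjacent {u} {v} u≁v = record { len = 1 ; walk = cons u≁v nil ; shortest = shortest }
    where
    shortest : ∀ ℓ → Walk G u v ℓ → 1 ≤ ℓ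
    shortest zero    w = contradiction (cong part (walk₀⇒≡ w)) u≁v
    shortest (suc _) _ = s≤s z≤n

  geodesic-via : ∀ {u v} w → part u ≡ part v → u ≢ v → part u ≢ part w → part w ≢ part v → Geodesic G u v
  geodesic-via {u} {v} w u∼v u≢v u≁w w≁v =
    record { len = 2 ; walk = cons {w = w} u≁w (cons w≁v nil) ; shortest = shortest }
    where
    shortest : ∀ ℓ → Walk G u v ℓ → 2 ≤ ℓ
    shortest zero          w              = contradiction (walk₀⇒≡ w) u≢v
    shortest (suc zero)    (cons u≁v nil) = contradiction u∼v u≁v
    shortest (suc (suc _)) _              = s≤s (s≤s z≤n)

  collect : ((i : Fin k) → List (Fin (n i))) → List V
  collect bs = concat (tabulate λ i → map (vertex i) (bs i))

  ∈-collect : ∀ {bs i a} → a ∈ bs i → vertex i a ∈ collect bs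
  ∈-collect {i = i} a∈ = ∈-concat⁺′ (∈-map⁺ (vertex i) a∈) (∈-tabulate⁺ i)

  collect-unique : ∀ {bs} → (∀ i → Unique (bs i)) → Unique (collect bs)
  collect-unique {bs} unique = Unique.concat⁺
    (All.tabulate⁺ λ i → Unique.map⁺ (,-injectiveʳ-UIP (Decidable⇒UIP.≡-irrelevant Finₚ._≟_)) (unique i))
    (AllPairs.tabulate⁺ disjoint)
    where
    part-∈ : ∀ {i v} {as : List (Fin (n i))} → v ∈ map (vertex i) as → part v ≡ i
    part-∈ v∈ with _ , _ , refl ← ∈-map⁻ (vertex _) v∈ = refl

    disjoint : ∀ {i j} → i ≢ j → ∀ {v} → v ∈ map (vertex i) (bs i) × v ∈ map (vertex j) (bs j) → ⊥
    disjoint i≢j (v∈i , v∈j) = i≢j (trans (sym (part-∈ v∈i)) (part-∈ v∈j))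

  length-collect : ∀ bs → length (collect bs) ≡ sumFin k (length ∘ bs)
  length-collect bs = begin
    length (collect bs)                                       ≡⟨ length-concat (tabulate λ i → map (vertex i) (bs i)) ⟩
    sum (map length (tabulate λ i → map (vertex i) (bs i)))   ≡⟨ cong sum (map-tabulate (λ i → map (vertex i) (bs i)) length) ⟩
    sum (tabulate λ i → length (map (vertex i) (bs i)))       ≡⟨ cong sum (tabulate-cong λ i → length-map (vertex i) (bs i)) ⟩
    sum (tabulate (length ∘ bs))                              ∎
    where open ≡-Reasoning

  atMost-outside⇒count : ∀ {b} (S : List V) → AtMost b (_∉ S) → sumFin k n ≤ length S + b
  atMost-outside⇒count {b} S (W , |W|≤b , outside⊆W) = begin
    sumFin k n                    ≡⟨ length-vertices ⟨
    length (collect (allFin ∘ n)) ≤⟨ unique-⊆⇒length≤ (collect-unique λ i → Unique.allFin⁺ (n i)) (λ {v} _ → ∈-S++W v) ⟩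
    length (S ++ W)               ≡⟨ length-++ S ⟩
    length S + length W           ≤⟨ +-monoʳ-≤ (length S) |W|≤b ⟩
    length S + b                  ∎
    where
    open ≤-Reasoning
    length-vertices : length (collect (allFin ∘ n)) ≡ sumFin k n
    length-vertices = trans (length-collect (allFin ∘ n))
      (cong sum (tabulate-cong {f = length ∘ allFin ∘ n} {g = n} λ i → length-tabulate (λ a → a)))

    ∈-S++W : ∀ v → v ∈ S ++ W
    ∈-S++W v with ∈? _≟ᵛ_ v S
    ... | yes v∈S = ∈-++⁺ˡ v∈S
    ... | no v∉S  = ∈-++⁺ʳ S (outside⊆W v∉S)

  atMost-part : ∀ {T : V → Set} P → (∀ {y} → T y → part y ≡ P) → AtMost (n P) T
  atMost-part {T} P in-P =
    map (vertex P) (allFin (n P)) ,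
    ≤-reflexive (trans (length-map (vertex P) (allFin (n P))) (length-tabulate (λ a → a))) ,
    ∈-part
    where
    ∈-part : ∀ {y} → T y → y ∈ map (vertex P) (allFin (n P))
    ∈-part {i , a} Ty with refl ← in-P Ty = ∈-map⁺ (vertex P) (∈-allFin a)

  module Connected (away : ∀ i → Σ V λ w → part w ≢ i) where

    geodesic-length≤2 : ∀ {u v} (g : Geodesic G u v) → Geodesic.len g ≤ 2
    geodesic-length≤2 {u} {v} g with part u Finₚ.≟ part v | away (part u)
    ... | yes u∼v | w , w≁u =
      Geodesic.shortest g 2 (cons {w = w} (w≁u ∘ sym) (cons (λ w∼v → w≁u (trans w∼v (sym u∼v))) nil))
    ... | no u≁v  | _       = ≤-trans (Geodesic.shortest g 1 (cons u≁v nil)) (s≤s z≤n)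

    geodesic-interior : ∀ {u v x y} (g : Geodesic G u v) → EdgeOn G x y (Geodesic.walk g) → y ≢ u → y ≢ v →
                        second (Geodesic.walk g) ≡ y × (x ≡ u ⊎ x ≡ v) × part u ≡ part v
    geodesic-interior {u} {v} g on y≢u y≢v
      with len≡2 , second≡y , x≡u⊎v ← edgeOn-interior (Geodesic.walk g) (geodesic-length≤2 g) on y≢u y≢v
      with part u Finₚ.≟ part v
    ... | yes u∼v = second≡y , x≡u⊎v , u∼v
    ... | no u≁v  = contradiction (subst (_≤ 1) len≡2 (Geodesic.shortest g 1 (cons u≁v nil))) λ { (s≤s ()) }

    module OutsideOf (S : List V) (seg : StrongEdgeGeodetic G S) where

      L : ℕ
      L = length S

      σ : (i j : Fin L) → Maybe (Geodesic G (lookup S i) (lookup S j))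
      σ = proj₁ (proj₂ seg)

      lookup-≡ : ∀ {i j} → lookup S i ≡ lookup S j → i ≡ j
      lookup-≡ = lookup-injective (proj₁ seg) _ _

      outside-≢ : ∀ {y} → y ∉ S → ∀ i → y ≢ lookup S i
      outside-≢ y∉S i y≡ = y∉S (subst (_∈ S) (sym y≡) (∈-lookup i))

      midpoint : ∀ {u v} → Maybe (Geodesic G u v) → V
      midpoint {u} nothing = u
      midpoint (just g)    = second (Geodesic.walk g)

      mid : Fin L → Fin L → V
      mid i j with Finₚ.<-cmp i j
      ... | tri< _ _ _ = midpoint (σ i j)
      ... | tri≈ _ _ _ = lookup S i
      ... | tri> _ _ _ = midpoint (σ j i)

      mid-< : ∀ {i j} → i F.< j → mid i j ≡ midpoint (σ i j)
      mid-< {i} {j} i<j with Finₚ.<-cmp i j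
      ... | tri< _ _ _   = refl
      ... | tri≈ i≮j _ _ = contradiction i<j i≮j
      ... | tri> i≮j _ _ = contradiction i<j i≮j

      mid-> : ∀ {i j} → j F.< i → mid i j ≡ midpoint (σ j i)
      mid-> {i} {j} j<i with Finₚ.<-cmp i j
      ... | tri< _ _ j≮i = contradiction j<i j≮i
      ... | tri≈ _ _ j≮i = contradiction j<i j≮i
      ... | tri> _ _ _   = refl

      mid-sym : ∀ i j → mid i j ≡ mid j i
      mid-sym i j = byOrder (Finₚ.<-cmp i j)
        where
        byOrder : Tri (i F.< j) (i ≡ j) (j F.< i) → mid i j ≡ mid j i
        byOrder (tri< i<j _ _) = trans (mid-< i<j) (sym (mid-> i<j))
        byOrder (tri≈ _ i≡j _) = subst (λ j → mid i j ≡ mid j i) i≡j refl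
        byOrder (tri> _ _ j<i) = trans (mid-> j<i) (sym (mid-< j<i))

      outside-mid : ∀ {x y} → y ∉ S → part x ≢ part y → Σ (Fin L) λ i → Σ (Fin L) λ j →
                    i F.< j × mid i j ≡ y × (x ≡ lookup S i ⊎ x ≡ lookup S j) × part (lookup S i) ≡ part (lookup S j)
      outside-mid {x} {y} y∉S x≁y
        with i , j , i<j , g , σij≡g , on ← proj₂ (proj₂ seg) x y x≁y
        with second≡y , x≡end , i∼j ← geodesic-interior g on (outside-≢ y∉S i) (outside-≢ y∉S j)
        = i , j , i<j , trans (mid-< i<j) (trans (cong midpoint σij≡g) second≡y) , x≡end , i∼j

      outside-same-part : ∀ {x y} → x ∉ S → y ∉ S → part x ≡ part y
      outside-same-part {x} {y} x∉S y∉S with part x Finₚ.≟ part y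
      ... | yes x∼y = x∼y
      ... | no x≁y with outside-mid y∉S x≁y
      ...   | _ , _ , _ , _ , inj₁ x≡i , _ = contradiction x≡i (outside-≢ x∉S _)
      ...   | _ , _ , _ , _ , inj₂ x≡j , _ = contradiction x≡j (outside-≢ x∉S _)

      outside-part : Fin k → Σ (Fin k) λ P → ∀ {y} → y ∉ S → part y ≡ P
      outside-part i₀ with Finₚ.any? (λ i → Finₚ.any? (λ a → ¬? (∈? _≟ᵛ_ (vertex i a) S)))
      ... | yes (P , _ , y₀∉S) = P , λ y∉S → outside-same-part y∉S y₀∉S
      ... | no none            = i₀ , λ {(i , a)} y∉S → contradiction (i , a , y∉S) none

      -- On a part Q ≠ P lying inside S, mid is a colouring of K_(n Q) in which every vertex
      -- meets every vertex outside S.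
      module Part (P : Fin k) (outside⊆P : ∀ {y} → y ∉ S → part y ≡ P) (Q : Fin k) (Q≢P : Q ≢ P) where

        inS : ∀ b → vertex Q b ∈ S
        inS b with ∈? _≟ᵛ_ (vertex Q b) S
        ... | yes ∈S = ∈S
        ... | no ∉S  = contradiction (outside⊆P ∉S) Q≢P

        idx : Fin (n Q) → Fin L
        idx b = index (inS b)

        idx-≡ : ∀ {b i} → vertex Q b ≡ lookup S i → idx b ≡ i
        idx-≡ {b} b≡i = lookup-≡ (trans (sym (lookup-index (inS b))) b≡i)

        colour : Fin (n Q) → Fin (n Q) → V
        colour b c = mid (idx b) (idx c)

        colour-sym : ∀ b c → colour b c ≡ colour c b
        colour-sym b c = mid-sym (idx b) (idx c)

        across : ∀ {b y i j} → i ≢ j → mid i j ≡ y → vertex Q b ≡ lookup S i → part (lookup S j) ≡ Q →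
                 ∃ λ c → c ≢ b × colour b c ≡ y
        across {b} {y} {i} {j} i≢j midij≡y b≡i j∈Q with (_ , c) ← lookup S j in c≡j | j∈Q
        ... | refl = c , (λ { refl → i≢j (trans (sym (idx-≡ b≡i)) (idx-≡ (sym c≡j))) })
                       , trans (cong₂ mid (idx-≡ b≡i) (idx-≡ (sym c≡j))) midij≡y

        meets : ∀ b {y} → y ∉ S → ∃ λ c → c ≢ b × colour b c ≡ y
        meets b {y} y∉S with outside-mid y∉S (λ Q∼y → Q≢P (trans Q∼y (outside⊆P y∉S)))
        ... | i , j , i<j , midij≡y , inj₁ b≡i , i∼j =
          across (Finₚ.<⇒≢ i<j) midij≡y b≡i (trans (sym i∼j) (cong part (sym b≡i)))
        ... | i , j , i<j , midij≡y , inj₂ b≡j , i∼j =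
          across (Finₚ.<⇒≢ i<j ∘ sym) (trans (mid-sym j i) midij≡y) b≡j (trans i∼j (cong part (sym b≡j)))

        atMost-δ : Fin (n Q) → AtMost (δ (n Q)) (_∉ S)
        atMost-δ b₀ = colourClasses-atMost _≟ᵛ_ (λ y → ¬? (∈? _≟ᵛ_ y S)) b₀ colour colour-sym meets

-- S omits the vertices (0, a) with a < t, and two vertices of part j + 1 whose colour c is
-- below t are joined through the omitted vertex (0, c).
module Construction {m : ℕ} (n : Fin (suc m) → ℕ) (t : ℕ) (t≤n₀ : t ≤ n zero)
  {D : Fin m → ℕ} (C : ∀ j → FullColouring (n (suc j)) (D j)) (t≤D : ∀ j → t ≤ D j) where

  open CompleteMultipartite n
  module C j = FullColouring (C j)

  shift : Fin (n zero ∸ t) → Fin (n zero)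
  shift c = fromℕ< (subst (t + toℕ c <_) (m+[n∸m]≡n t≤n₀) (+-monoʳ-< t (Finₚ.toℕ<n c)))

  shift-injective : ∀ {c c′} → shift c ≡ shift c′ → c ≡ c′
  shift-injective {c} {c′} eq = Finₚ.toℕ-injective (+-cancelˡ-≡ t _ _
    (trans (sym (Finₚ.toℕ-fromℕ< _)) (trans (cong toℕ eq) (Finₚ.toℕ-fromℕ< _))))

  ∈-shift : ∀ {a} → t ≤ toℕ a → a ∈ tabulate shift
  ∈-shift {a} t≤a = subst (_∈ tabulate shift) (Finₚ.toℕ-injective toℕ-shift) (∈-tabulate⁺ c)
    where
    c = fromℕ< (∸-monoˡ-< (Finₚ.toℕ<n a) t≤a)
    toℕ-shift : toℕ (shift c) ≡ toℕ a
    toℕ-shift = trans (Finₚ.toℕ-fromℕ< _) (trans (cong (t +_) (Finₚ.toℕ-fromℕ< _)) (m+[n∸m]≡n t≤a))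

  kept : (i : Fin (suc m)) → List (Fin (n i))
  kept zero    = tabulate shift
  kept (suc j) = allFin (n (suc j))

  kept-unique : ∀ i → Unique (kept i)
  kept-unique zero    = Unique.tabulate⁺ shift-injective
  kept-unique (suc j) = Unique.allFin⁺ (n (suc j))

  S : List V
  S = collect kept

  length-S : length S ≡ sumFin m (n ∘ suc) + (n zero ∸ t)
  length-S = trans (length-collect kept)
    (trans (cong₂ _+_ (length-tabulate shift) (cong sum (tabulate-cong {f = length ∘ kept ∘ suc} {g = n ∘ suc}
                                                          λ j → length-tabulate (λ a → a))))
           (+-comm (n zero ∸ t) (sumFin m (n ∘ suc))))

  data Omitted : V → Set where
    omitted : ∀ {a} → toℕ a < t → Omitted (vertex zero a)

  ∉S⇒omitted : ∀ {v} → v ∉ S → Omitted v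
  ∉S⇒omitted {suc j , a} v∉S = contradiction (∈-collect {bs = kept} (∈-allFin a)) v∉S
  ∉S⇒omitted {zero , a}  v∉S with toℕ a <? t
  ... | yes a<t = omitted a<t
  ... | no a≮t  = contradiction (∈-collect {bs = kept} (∈-shift (≮⇒≥ a≮t))) v∉S

  hub : ∀ {c} → c < t → V
  hub c<t = vertex zero (fromℕ< (<-≤-trans c<t t≤n₀))

  viaHub : ∀ j (a b : Fin (n (suc j))) → Maybe (Geodesic G (vertex (suc j) a) (vertex (suc j) b))
  viaHub j a b with vertex (suc j) a ≟ᵛ vertex (suc j) b | C.colour j (toℕ a) (toℕ b) <? t
  ... | no a≢b | yes c<t = just (geodesic-via (hub c<t) refl a≢b (λ ()) (λ ()))
  ... | _      | _       = nothing

  τ : (u v : V) → Maybe (Geodesic G u v)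
  τ (i , a) (i′ , b) with i Finₚ.≟ i′
  ... | no i≁i′ = just (geodesic-adjacent i≁i′)
  ... | yes refl with i
  ...   | zero  = nothing
  ...   | suc j = viaHub j a b

  covers-adjacent : ∀ {x y} → part x ≢ part y → Covers τ x y x y
  covers-adjacent {i , a} {i′ , b} x≁y with i Finₚ.≟ i′
  ... | yes i≡i′ = contradiction i≡i′ x≁y
  ... | no i≢i′  = geodesic-adjacent i≢i′ , refl , here _ nil (inj₁ (refl , refl))

  covers-hub : ∀ {j a b x} {y₀ : Fin (n zero)} → toℕ y₀ < t → vertex (suc j) a ≢ vertex (suc j) b →
               C.colour j (toℕ a) (toℕ b) ≡ toℕ y₀ → x ≡ vertex (suc j) a ⊎ x ≡ vertex (suc j) b →
               Covers τ x (vertex zero y₀) (vertex (suc j) a) (vertex (suc j) b)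
  covers-hub {j} {a} {b} {x} {y₀} y₀<t a≢b colour≡y₀ x≡end with suc j Finₚ.≟ suc j
  ... | no j≢j = contradiction refl j≢j
  ... | yes refl with vertex (suc j) a ≟ᵛ vertex (suc j) b | C.colour j (toℕ a) (toℕ b) <? t
  ...   | yes a≡b | _       = contradiction a≡b a≢b
  ...   | no _    | no c≮t  = contradiction (subst (_< t) (sym colour≡y₀) y₀<t) c≮t
  ...   | no _    | yes c<t = _ , refl , on x≡end
    where
    hub≡y₀ : hub c<t ≡ vertex zero y₀
    hub≡y₀ = cong (vertex zero) (Finₚ.toℕ-injective (trans (Finₚ.toℕ-fromℕ< _) colour≡y₀))

    on : x ≡ vertex (suc j) a ⊎ x ≡ vertex (suc j) b →
         EdgeOn G x (vertex zero y₀) (cons {w = hub c<t} (λ ()) (cons (λ ()) nil))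
    on (inj₁ x≡a) = here _ _ (inj₁ (sym x≡a , hub≡y₀))
    on (inj₂ x≡b) = there _ (here _ _ (inj₂ (hub≡y₀ , sym x≡b)))

  Covered : V → V → Set
  Covered x y = Σ V λ u → Σ V λ v → u ∈ S × v ∈ S × u ≢ v × Covers τ x y u v × Covers τ x y v u

  covered-sym : ∀ {x y} → Covered x y → Covered y x
  covered-sym (u , v , u∈S , v∈S , u≢v , uv , vu) =
    u , v , u∈S , v∈S , u≢v , covers-sym {τ = τ} uv , covers-sym {τ = τ} vu

  covered-omitted : ∀ {x y} → x ∈ S → y ∉ S → part x ≢ part y → Covered x y
  covered-omitted {zero , a} x∈S y∉S x≁y with ∉S⇒omitted y∉S
  ... | omitted _ = contradiction refl x≁y
  covered-omitted {suc j , a} x∈S y∉S x≁y with ∉S⇒omitted y∉S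
  ... | omitted {y₀} y₀<t =
    vertex (suc j) a , vertex (suc j) b , x∈S , ∈-collect {bs = kept} (∈-allFin b) , a≢b ,
    covers-hub y₀<t a≢b colour≡y₀ (inj₁ refl) ,
    covers-hub y₀<t (a≢b ∘ sym) (trans (C.colour-sym j _ _) colour≡y₀) (inj₂ refl)
    where
    y₀<D = <-≤-trans y₀<t (t≤D j)
    b = fromℕ< (C.partner< j (Finₚ.toℕ<n a) y₀<D)

    a≢b : vertex (suc j) a ≢ vertex (suc j) b
    a≢b a≡b = C.partner≢ j (Finₚ.toℕ<n a) y₀<D (trans (sym (Finₚ.toℕ-fromℕ< _)) (cong (toℕ ∘ proj₂) (sym a≡b)))

    colour≡y₀ : C.colour j (toℕ a) (toℕ b) ≡ toℕ y₀
    colour≡y₀ = trans (cong (C.colour j (toℕ a)) (Finₚ.toℕ-fromℕ< _)) (C.colour-partner j (Finₚ.toℕ<n a) y₀<D)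

  covered : ∀ x y → part x ≢ part y → Covered x y
  covered x y x≁y with ∈? _≟ᵛ_ x S | ∈? _≟ᵛ_ y S
  ... | yes x∈S | yes y∈S = x , y , x∈S , y∈S , x≁y ∘ cong part ,
                            covers-adjacent x≁y , covers-sym {τ = τ} (covers-adjacent (x≁y ∘ sym))
  ... | yes x∈S | no y∉S  = covered-omitted x∈S y∉S x≁y
  ... | no x∉S  | yes y∈S = covered-sym (covered-omitted y∈S x∉S (x≁y ∘ sym))
  ... | no x∉S  | no y∉S  with ∉S⇒omitted x∉S | ∉S⇒omitted y∉S
  ...   | omitted _ | omitted _ = contradiction refl x≁y

  strongEdgeGeodetic : StrongEdgeGeodetic G S
  strongEdgeGeodetic = assignment⇒strongEdgeGeodetic S (collect-unique kept-unique) τ covered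

-- The strong edge geodetic number

module Bounds (m : ℕ) (n : Fin (suc (suc m)) → ℕ) (2≤n : ∀ i → 2 ≤ n i) where
  open CompleteMultipartite n

  n₀ n₁ s : ℕ
  n₀ = n zero
  n₁ = n (suc zero)
  s  = sumFin (suc m) (n ∘ suc)

  someVertex : ∀ i → Fin (n i)
  someVertex i = fromℕ< (≤-trans (s≤s z≤n) (2≤n i))

  away : ∀ i → Σ V λ w → part w ≢ i
  away zero    = vertex (suc zero) (someVertex _) , λ ()
  away (suc _) = vertex zero (someVertex _) , λ ()

  open Connected away

  module _ (S : List V) (seg : StrongEdgeGeodetic G S) where
    open OutsideOf S seg

    outside-atMost : AtMost (δ n₀) (_∉ S) ⊎ AtMost n₀ (_∉ S) × AtMost (δ n₁) (_∉ S)
    outside-atMost with outside-part zero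
    ... | P , outside⊆P with P Finₚ.≟ zero
    ...   | no P≢0   = inj₁ (Part.atMost-δ P outside⊆P zero (P≢0 ∘ sym) (someVertex zero))
    ...   | yes refl = inj₂ (atMost-part zero outside⊆P ,
                             Part.atMost-δ zero outside⊆P (suc zero) (λ ()) (someVertex _))

  lower-bound : ∀ {t} → δ n₀ ≤ t → n₀ ≤ t ⊎ δ n₁ ≤ t →
                ∀ S → StrongEdgeGeodetic G S → n₀ + s ≤ length S + t
  lower-bound {t} δn₀≤t n₀⊎δn₁≤t S seg = atMost-outside⇒count S (bound (outside-atMost S seg) n₀⊎δn₁≤t)
    where
    bound : AtMost (δ n₀) (_∉ S) ⊎ AtMost n₀ (_∉ S) × AtMost (δ n₁) (_∉ S) →
            n₀ ≤ t ⊎ δ n₁ ≤ t → AtMost t (_∉ S)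
    bound (inj₁ atMost-δn₀)       _            = atMost-mono δn₀≤t atMost-δn₀
    bound (inj₂ (atMost-n₀ , _))  (inj₁ n₀≤t)  = atMost-mono n₀≤t atMost-n₀
    bound (inj₂ (_ , atMost-δn₁)) (inj₂ δn₁≤t) = atMost-mono δn₁≤t atMost-δn₁

  upper-bound : ∀ {t} → t ≤ n₀ → (∀ j → t ≤ δ (n (suc j))) →
                ∃[ S ] (StrongEdgeGeodetic G S × length S ≡ s + (n₀ ∸ t))
  upper-bound {t} t≤n₀ t≤δ = S , strongEdgeGeodetic , length-S
    where open Construction n t t≤n₀ (λ j → fullColouring (n (suc j)) (2≤n (suc j))) t≤δ

  isSge : ∀ t → t ≤ n₀ → (∀ j → t ≤ δ (n (suc j))) → δ n₀ ≤ t → n₀ ≤ t ⊎ δ n₁ ≤ t →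
          IsSge G (s + (n₀ ∸ t))
  isSge t t≤n₀ t≤δ δn₀≤t n₀⊎δn₁≤t = upper-bound t≤n₀ t≤δ , λ S seg → +-cancelʳ-≤ t _ _ (begin
    s + (n₀ ∸ t) + t   ≡⟨ +-assoc s (n₀ ∸ t) t ⟩
    s + (n₀ ∸ t + t)   ≡⟨ cong (s +_) (m∸n+n≡m t≤n₀) ⟩
    s + n₀             ≡⟨ +-comm s n₀ ⟩
    n₀ + s             ≤⟨ lower-bound δn₀≤t n₀⊎δn₁≤t S seg ⟩
    length S + t       ∎)
    where open ≤-Reasoning

module Cases (m : ℕ) (n : Fin (suc (suc m)) → ℕ) (2≤n₀ : 2 ≤ n zero)
             (mono : ∀ i j → i F.≤ j → n i ≤ n j) where

  open Bounds m n (λ i → ≤-trans 2≤n₀ (mono zero i z≤n))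
  open CompleteMultipartite n using (G)

  n₀≤ : ∀ j → n₀ ≤ n (suc j)
  n₀≤ j = mono zero (suc j) z≤n

  n₁≤ : ∀ j → n₁ ≤ n (suc j)
  n₁≤ j = mono (suc zero) (suc j) (s≤s z≤n)

  isSge-s : (∀ j → n₀ ≤ δ (n (suc j))) → IsSge G s
  isSge-s n₀≤δ = subst (IsSge G) (trans (cong (s +_) (n∸n≡0 n₀)) (+-identityʳ s))
                     (isSge n₀ ≤-refl n₀≤δ (δ≤ n₀) (inj₁ ≤-refl))

  even-near : 2 ∣ n₀ → n₁ ≡ n₀ ⊎ n₁ ≡ suc n₀ → IsSge G (s + 1)
  even-near 2∣n₀ n₁≈n₀ = subst (λ c → IsSge G (s + c)) (m∸[m∸n]≡n (≤-trans (s≤s z≤n) 2≤n₀))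
    (isSge (n₀ ∸ 1) (m∸n≤m n₀ 1) (λ j → even≤⇒∸1≤δ 2∣n₀ (n₀≤ j))
         (≤-reflexive (δ-even 2∣n₀)) (inj₂ (≤-reflexive (δn₁ n₁≈n₀))))
    where
    δn₁ : n₁ ≡ n₀ ⊎ n₁ ≡ suc n₀ → δ n₁ ≡ n₀ ∸ 1
    δn₁ (inj₁ n₁≡n₀)   = trans (cong δ n₁≡n₀) (δ-even 2∣n₀)
    δn₁ (inj₂ n₁≡1+n₀) = trans (cong δ n₁≡1+n₀) (δ-odd (2∣⇒¬2∣suc 2∣n₀))

  even-far : 2 ∣ n₀ → ¬ (n₁ ≡ n₀ ⊎ n₁ ≡ suc n₀) → IsSge G s
  even-far _ n₁≉n₀ = isSge-s λ j → ≤-trans (m+n≤o⇒m≤o∸n n₀ (≤-trans n₀+2≤n₁ (n₁≤ j))) (∸2≤δ (n (suc j)))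
    where
    n₀+2≤n₁ : n₀ + 2 ≤ n₁
    n₀+2≤n₁ = subst (_≤ n₁) (+-comm 2 n₀)
      (≤∧≢⇒< (≤∧≢⇒< (mono zero (suc zero) z≤n) (n₁≉n₀ ∘ inj₁ ∘ sym)) (n₁≉n₀ ∘ inj₂ ∘ sym))

  odd-equal : ¬ 2 ∣ n₀ → n₁ ≡ n₀ → IsSge G (s + 2)
  odd-equal ¬2∣n₀ n₁≡n₀ = subst (λ c → IsSge G (s + c)) (m∸[m∸n]≡n 2≤n₀)
    (isSge (n₀ ∸ 2) (m∸n≤m n₀ 2) (λ j → ≤-trans (∸-monoˡ-≤ 2 (n₀≤ j)) (∸2≤δ (n (suc j))))
         (≤-reflexive (δ-odd ¬2∣n₀)) (inj₂ (≤-reflexive (trans (cong δ n₁≡n₀) (δ-odd ¬2∣n₀)))))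

  odd-far : ¬ 2 ∣ n₀ → ¬ (n₁ ≡ n₀) → IsSge G s
  odd-far ¬2∣n₀ n₁≢n₀ = isSge-s λ j → odd<⇒≤δ ¬2∣n₀
    (≤-trans (≤∧≢⇒< (mono zero (suc zero) z≤n) (n₁≢n₀ ∘ sym)) (n₁≤ j))

theorem2p7 : (m : ℕ) (n : Fin (suc (suc m)) → ℕ) →
    2 ≤ n zero →
    (∀ i j → i F.≤ j → n i ≤ n j) →
    let G = completeMultipartite (suc (suc m)) n
        s = sumFin (suc m) (λ j → n (suc j))
        n₁ = n zero
        n₂ = n (suc zero)
    in ((2 ∣ n₁) →
          ((n₂ ≡ n₁ ⊎ n₂ ≡ suc n₁) → IsSge G (s + 1)) ×
          (¬ (n₂ ≡ n₁ ⊎ n₂ ≡ suc n₁) → IsSge G s)) ×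
       (¬ (2 ∣ n₁) →
          (n₂ ≡ n₁ → IsSge G (s + 2)) ×
          (¬ (n₂ ≡ n₁) → IsSge G s))
theorem2p7 m n 2≤n₀ mono =
  (λ 2∣n₀ → even-near 2∣n₀ , even-far 2∣n₀) , (λ ¬2∣n₀ → odd-equal ¬2∣n₀ , odd-far ¬2∣n₀)
  where open Cases m n 2≤n₀ mono
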